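{- For all integers $i\ge 0$ and $j\ge 0$ define \[ \tilde\sigma_{ij}=2\sum_{k=0}^i\sum_{l=0}^j\frac{(-1)^{k+l}}{k+l+4}\binom{i}{k}\binom{j}{l}\left(\frac{2(k+l+4)!}{(k+3)!\,(l+3)!}-1-\frac{(k+1)(l+1)}{(k+3)(l+3)}\right). \] Then for all integers $i\ge0$, $j\ge0$ with $i\ne j$, \[ \tilde\sigma_{ij}=\frac{16}{(i+3)_3\,(j+3)_3}-\frac{24}{(i+j+4)_4}, \] and for every integer $j\ge 0$, \[ \tilde\sigma_{jj}=\frac{4}{(j+3)_3}+\frac{16}{(j+3)_3^2}-\frac{24}{(2j+4)_4}. \]
   Context: $(x)_m=x(x-1)\cdots(x-(m-1))$ denotes the falling factorial. (The quantities $\tilde\sigma_{ij}$ are the entries of the limiting covariance matrix of the outdegree counts in a random plane recursive tree, as given by Janson; the claim is the stated identity for the double sum.) -}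

module Defs where

open import Data.Nat as ℕ using (ℕ; zero; suc; _!)
open import Data.Nat.Combinatorics using (_C_)
open import Data.Integer as ℤ using (ℤ; +_)
open import Data.Nat.Properties using (_!≢0; m*n≢0)
open import Data.Rational using (ℚ; _/_; _+_; _-_; _*_; -_; 0ℚ; 1ℚ)

_falling_ : ℕ → ℕ → ℕ
x falling zero = 1
x falling suc m = x ℕ.* ((x ℕ.∸ 1) falling m)

sumTo : ℕ → (ℕ → ℚ) → ℚ
sumTo zero f = f zero
sumTo (suc n) f = sumTo n f + f (suc n)

sgn : ℕ → ℚ
sgn zero = 1ℚ
sgn (suc n) = - sgn n

ℕ→ℚ : ℕ → ℚ
ℕ→ℚ n = + n / 1

term : ℕ → ℕ → ℕ → ℕ → ℚ
term i j k l =
  sgn (k ℕ.+ l) * (+ 1 / (4 ℕ.+ k ℕ.+ l)) * ℕ→ℚ (i C k) * ℕ→ℚ (j C l)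
  * ( (+ (2 ℕ.* ((4 ℕ.+ k ℕ.+ l) !)) / ((3 ℕ.+ k) ! ℕ.* (3 ℕ.+ l) !))
      - 1ℚ
      - (+ ((1 ℕ.+ k) ℕ.* (1 ℕ.+ l)) / ((3 ℕ.+ k) ℕ.* (3 ℕ.+ l))) )
  where
  instance
    nz : ℕ.NonZero ((3 ℕ.+ k) ! ℕ.* (3 ℕ.+ l) !)
    nz = m*n≢0 ((3 ℕ.+ k) !) ((3 ℕ.+ l) !) {{(3 ℕ.+ k) !≢0}} {{(3 ℕ.+ l) !≢0}}

σ̃ : ℕ → ℕ → ℚ
σ̃ i j = (+ 2 / 1) * sumTo i (λ k → sumTo j (λ l → term i j k l))

-- Write Δᵢ f = Σₖ (-1)ᵏ C(i,k) f(k), the i-th iterate of the backward difference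
-- f ↦ (k ↦ f k - f (k+1)) evaluated at 0.  Absorbing the factor 1/(k+l+4), the summand of σ̃ᵢⱼ is
-- (-1)ᵏ C(i,k) (-1)ˡ C(j,l) · 2K(k,l) with
--   K(k,l) = (k+l+3)!/((k+3)!(l+3)!) - 1/(k+l+4) + 1/((k+3)(l+3)),
-- so σ̃ᵢⱼ = 4 ΔᵢΔⱼ K.  The first summand is (l+k+3)ₖ/(k+3)!, a polynomial of degree k in l:
-- Δⱼ of it is (-1)ʲ (k)ⱼ/(j+3)!, and Δᵢ of the falling factorial (k)ⱼ vanishes unless i = j,
-- which produces the extra diagonal term.  The other summands are reciprocals of rising
-- factorials, for which Δ telescopes: Δᵢ of k ↦ 1/((k+a+1)⋯(k+a+m)) is
-- m(m+1)⋯(m+i-1)/((a+1)⋯(a+m+i)).  This gives 6/(i+j+4)₄ and (2/(i+3)₃)(2/(j+3)₃).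

module Submission where

open import Defs
open import Data.Nat as ℕ using (ℕ; zero; suc; _!; NonZero)
import Data.Nat.Properties as ℕ
open import Data.Nat.Combinatorics using (_C_; nCk+nC[k+1]≡[n+1]C[k+1])
open import Data.Nat.Combinatorics.Specification using (k>n⇒nCk≡0)
open import Data.Nat.Tactic.RingSolver renaming (solve to ℕ-solve; solve-∀ to ℕ-solve-∀)
open import Data.Integer as ℤ using (+_)
import Data.Integer.Properties as ℤ
import Data.Integer.Tactic.RingSolver as ℤ-Solver
open import Data.Integer.GCD using (gcd)
open import Data.Rational using (ℚ; mkℚ; _/_; _+_; _-_; _*_; -_; 0ℚ; 1ℚ; ↥_; ↧_; ↧ₙ_)
open import Data.Rational.Properties as ℚ using (↥-/; ↧-/; fromℚᵘ-cong; /-cong)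
import Data.Rational.Unnormalised as ℚᵘ
open import Data.List using (_∷_; [])
open import Data.Product using (_×_; _,_)
open import Level using (0ℓ)
open import Relation.Binary.PropositionalEquality
open import Relation.Binary.Definitions using (tri<; tri≈; tri>)
open import Relation.Nullary.Decidable.Core using (dec⇒maybe; yes; no)
open import Relation.Nullary.Negation using (contradiction)
open import Algebra.Bundles using (CommutativeRing)
import Algebra.Properties.CommutativeSemigroup as CommSemigroupProperties
open import Algebra.Properties.Ring (CommutativeRing.ring ℚ.+-*-commutativeRing) using (-1*x≈-x)
open import Tactic.RingSolver using (solve-∀)
open import Tactic.RingSolver.Core.AlmostCommutativeRing using (AlmostCommutativeRing; fromCommutativeRing)

module ℕ+ = CommSemigroupProperties ℕ.+-commutativeSemigroup
module ℕ* = CommSemigroupProperties ℕ.*-commutativeSemigroup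
module ℤ* = CommSemigroupProperties ℤ.*-commutativeSemigroup
module ℚ+ = CommSemigroupProperties (CommutativeRing.+-commutativeSemigroup ℚ.+-*-commutativeRing)
module ℚ* = CommSemigroupProperties (CommutativeRing.*-commutativeSemigroup ℚ.+-*-commutativeRing)

ℚ-ring : AlmostCommutativeRing 0ℓ 0ℓ
ℚ-ring = fromCommutativeRing ℚ.+-*-commutativeRing (λ x → dec⇒maybe (0ℚ ℚ.≟ x))

private
  /≡/ᶻ : ∀ p₁ p₂ q₁ q₂ .{{_ : NonZero q₁}} .{{_ : NonZero q₂}} →
         p₁ ℤ.* + q₂ ≡ p₂ ℤ.* + q₁ → p₁ / q₁ ≡ p₂ / q₂
  /≡/ᶻ p₁ p₂ (suc m) (suc n) eq = fromℚᵘ-cong {ℚᵘ.mkℚᵘ p₁ m} {ℚᵘ.mkℚᵘ p₂ n} (ℚᵘ.*≡* eq)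

  ↥/-cross : ∀ p q .{{_ : NonZero q}} → ↥ (p / q) ℤ.* + q ≡ p ℤ.* ↧ (p / q)
  ↥/-cross p q = begin
    ↥ x ℤ.* + q          ≡⟨ cong (↥ x ℤ.*_) (↧-/ p q) ⟨
    ↥ x ℤ.* (↧ x ℤ.* g)  ≡⟨ ℤ*.x∙yz≈xz∙y (↥ x) (↧ x) g ⟩
    (↥ x ℤ.* g) ℤ.* ↧ x  ≡⟨ cong (ℤ._* ↧ x) (↥-/ p q) ⟩
    p ℤ.* ↧ x            ∎
    where
    open ≡-Reasoning
    x = p / q
    g = gcd p (+ q)

  *-def : ∀ x y → x * y ≡ (↥ x ℤ.* ↥ y) / (↧ₙ x ℕ.* ↧ₙ y)
  *-def (mkℚ _ _ _) (mkℚ _ _ _) = refl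

  +-def : ∀ x y → x + y ≡ (↥ x ℤ.* ↧ y ℤ.+ ↥ y ℤ.* ↧ x) / (↧ₙ x ℕ.* ↧ₙ y)
  +-def (mkℚ _ _ _) (mkℚ _ _ _) = refl

/≡/ : ∀ a b c d .{{_ : NonZero b}} .{{_ : NonZero d}} → a ℕ.* d ≡ c ℕ.* b → + a / b ≡ + c / d
/≡/ a b c d eq = /≡/ᶻ (+ a) (+ c) b d (trans (sym (ℤ.pos-* a d)) (trans (cong +_ eq) (ℤ.pos-* c b)))

/-*-/ : ∀ a b c d .{{_ : NonZero b}} .{{_ : NonZero d}} →
        ((+ a / b) * (+ c / d) ≡ (+ (a ℕ.* c) / (b ℕ.* d)) {{ℕ.m*n≢0 b d}})
/-*-/ a b c d = trans (*-def x y)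
  (/≡/ᶻ (↥ x ℤ.* ↥ y) (+ (a ℕ.* c)) (↧ₙ x ℕ.* ↧ₙ y) (b ℕ.* d) {{_}} {{ℕ.m*n≢0 b d}} cross-multiplied)
  where
  open ≡-Reasoning
  x = + a / b
  y = + c / d
  cross-multiplied : (↥ x ℤ.* ↥ y) ℤ.* + (b ℕ.* d) ≡ + (a ℕ.* c) ℤ.* + (↧ₙ x ℕ.* ↧ₙ y)
  cross-multiplied = begin
    (↥ x ℤ.* ↥ y) ℤ.* + (b ℕ.* d)      ≡⟨ cong ((↥ x ℤ.* ↥ y) ℤ.*_) (ℤ.pos-* b d) ⟩
    (↥ x ℤ.* ↥ y) ℤ.* (+ b ℤ.* + d)    ≡⟨ ℤ*.interchange (↥ x) (↥ y) (+ b) (+ d) ⟩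
    (↥ x ℤ.* + b) ℤ.* (↥ y ℤ.* + d)    ≡⟨ cong₂ ℤ._*_ (↥/-cross (+ a) b) (↥/-cross (+ c) d) ⟩
    (+ a ℤ.* ↧ x) ℤ.* (+ c ℤ.* ↧ y)    ≡⟨ ℤ*.interchange (+ a) (↧ x) (+ c) (↧ y) ⟩
    (+ a ℤ.* + c) ℤ.* (↧ x ℤ.* ↧ y)    ≡⟨ cong₂ ℤ._*_ (ℤ.pos-* a c) (ℤ.pos-* (↧ₙ x) (↧ₙ y)) ⟨
    + (a ℕ.* c) ℤ.* + (↧ₙ x ℕ.* ↧ₙ y)  ∎

/-+-/ : ∀ a b c d .{{_ : NonZero b}} .{{_ : NonZero d}} →
        ((+ a / b) + (+ c / d) ≡ (+ (a ℕ.* d ℕ.+ c ℕ.* b) / (b ℕ.* d)) {{ℕ.m*n≢0 b d}})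
/-+-/ a b c d = trans (+-def x y)
  (/≡/ᶻ (↥ x ℤ.* ↧ y ℤ.+ ↥ y ℤ.* ↧ x) (+ (a ℕ.* d ℕ.+ c ℕ.* b)) (↧ₙ x ℕ.* ↧ₙ y) (b ℕ.* d)
        {{_}} {{ℕ.m*n≢0 b d}} cross-multiplied)
  where
  open ≡-Reasoning
  x = + a / b
  y = + c / d
  expand : ∀ p q r s u v →
           (p ℤ.* s ℤ.+ r ℤ.* q) ℤ.* (u ℤ.* v) ≡ (p ℤ.* u) ℤ.* (s ℤ.* v) ℤ.+ (r ℤ.* v) ℤ.* (q ℤ.* u)
  expand = ℤ-Solver.solve-∀
  collect : ∀ p q r s u v →
            (p ℤ.* q) ℤ.* (s ℤ.* v) ℤ.+ (r ℤ.* s) ℤ.* (q ℤ.* u) ≡ (p ℤ.* v ℤ.+ r ℤ.* u) ℤ.* (q ℤ.* s)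
  collect = ℤ-Solver.solve-∀
  numerator : + (a ℕ.* d ℕ.+ c ℕ.* b) ≡ + a ℤ.* + d ℤ.+ + c ℤ.* + b
  numerator = trans (ℤ.pos-+ (a ℕ.* d) (c ℕ.* b)) (cong₂ ℤ._+_ (ℤ.pos-* a d) (ℤ.pos-* c b))
  cross-multiplied : (↥ x ℤ.* ↧ y ℤ.+ ↥ y ℤ.* ↧ x) ℤ.* + (b ℕ.* d)
                     ≡ + (a ℕ.* d ℕ.+ c ℕ.* b) ℤ.* + (↧ₙ x ℕ.* ↧ₙ y)
  cross-multiplied = begin
    (↥ x ℤ.* ↧ y ℤ.+ ↥ y ℤ.* ↧ x) ℤ.* + (b ℕ.* d)
      ≡⟨ cong ((↥ x ℤ.* ↧ y ℤ.+ ↥ y ℤ.* ↧ x) ℤ.*_) (ℤ.pos-* b d) ⟩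
    (↥ x ℤ.* ↧ y ℤ.+ ↥ y ℤ.* ↧ x) ℤ.* (+ b ℤ.* + d)
      ≡⟨ expand (↥ x) (↧ x) (↥ y) (↧ y) (+ b) (+ d) ⟩
    (↥ x ℤ.* + b) ℤ.* (↧ y ℤ.* + d) ℤ.+ (↥ y ℤ.* + d) ℤ.* (↧ x ℤ.* + b)
      ≡⟨ cong₂ (λ u v → u ℤ.* (↧ y ℤ.* + d) ℤ.+ v ℤ.* (↧ x ℤ.* + b))
               (↥/-cross (+ a) b) (↥/-cross (+ c) d) ⟩
    (+ a ℤ.* ↧ x) ℤ.* (↧ y ℤ.* + d) ℤ.+ (+ c ℤ.* ↧ y) ℤ.* (↧ x ℤ.* + b)
      ≡⟨ collect (+ a) (↧ x) (+ c) (↧ y) (+ b) (+ d) ⟩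
    (+ a ℤ.* + d ℤ.+ + c ℤ.* + b) ℤ.* (↧ x ℤ.* ↧ y)
      ≡⟨ cong₂ ℤ._*_ numerator (ℤ.pos-* (↧ₙ x) (↧ₙ y)) ⟨
    + (a ℕ.* d ℕ.+ c ℕ.* b) ℤ.* + (↧ₙ x ℕ.* ↧ₙ y) ∎

ℕ→ℚ-+ : ∀ m n → ℕ→ℚ (m ℕ.+ n) ≡ ℕ→ℚ m + ℕ→ℚ n
ℕ→ℚ-+ m n = sym (trans (/-+-/ m 1 n 1) (/≡/ (m ℕ.* 1 ℕ.+ n ℕ.* 1) 1 (m ℕ.+ n) 1 (ℕ-solve (m ∷ n ∷ []))))

ℕ→ℚ-* : ∀ m n → ℕ→ℚ (m ℕ.* n) ≡ ℕ→ℚ m * ℕ→ℚ n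
ℕ→ℚ-* m n = sym (trans (/-*-/ m 1 n 1) (/≡/ (m ℕ.* n) 1 (m ℕ.* n) 1 (ℕ-solve (m ∷ n ∷ []))))

ℕ→ℚ-*-/ : ∀ c a b .{{_ : NonZero b}} → ℕ→ℚ c * (+ a / b) ≡ + (c ℕ.* a) / b
ℕ→ℚ-*-/ c a b = trans (/-*-/ c 1 a b)
  (/≡/ (c ℕ.* a) (1 ℕ.* b) (c ℕ.* a) b {{ℕ.m*n≢0 1 b}} (ℕ-solve (c ∷ a ∷ b ∷ [])))

a/n≡a*1/n : ∀ a n .{{_ : NonZero n}} → + a / n ≡ ℕ→ℚ a * (+ 1 / n)
a/n≡a*1/n a n = sym (trans (ℕ→ℚ-*-/ a 1 n) (/≡/ (a ℕ.* 1) n a n (ℕ-solve (a ∷ n ∷ []))))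

1/n*n≡1 : ∀ n .{{_ : NonZero n}} → (+ 1 / n) * ℕ→ℚ n ≡ 1ℚ
1/n*n≡1 n = trans (/-*-/ 1 n n 1) (/≡/ (1 ℕ.* n) (n ℕ.* 1) 1 1 {{ℕ.m*n≢0 n 1}} (ℕ-solve (n ∷ [])))

*≡⇒≡/ : ∀ {x} a n .{{_ : NonZero n}} → ℕ→ℚ n * x ≡ ℕ→ℚ a → x ≡ + a / n
*≡⇒≡/ {x} a n nx≡a = begin
  x                        ≡⟨ ℚ.*-identityˡ x ⟨
  1ℚ * x                   ≡⟨ cong (_* x) (1/n*n≡1 n) ⟨
  (+ 1 / n) * ℕ→ℚ n * x    ≡⟨ ℚ.*-assoc (+ 1 / n) (ℕ→ℚ n) x ⟩
  (+ 1 / n) * (ℕ→ℚ n * x)  ≡⟨ cong ((+ 1 / n) *_) nx≡a ⟩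
  (+ 1 / n) * ℕ→ℚ a        ≡⟨ ℚ.*-comm (+ 1 / n) (ℕ→ℚ a) ⟩
  ℕ→ℚ a * (+ 1 / n)        ≡⟨ a/n≡a*1/n a n ⟨
  + a / n                  ∎
  where open ≡-Reasoning

sgn-+ : ∀ m n → sgn (m ℕ.+ n) ≡ sgn m * sgn n
sgn-+ zero    n = sym (ℚ.*-identityˡ (sgn n))
sgn-+ (suc m) n = trans (cong -_ (sgn-+ m n)) (ℚ.neg-distribˡ-* (sgn m) (sgn n))

sgn-*-sgn : ∀ n → sgn n * sgn n ≡ 1ℚ
sgn-*-sgn zero    = refl
sgn-*-sgn (suc n) = trans (neg-*-neg (sgn n)) (sgn-*-sgn n)
  where
  neg-*-neg : ∀ s → - s * - s ≡ s * s
  neg-*-neg = solve-∀ ℚ-ring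

sumTo-cong : ∀ n {f g : ℕ → ℚ} → (∀ k → f k ≡ g k) → sumTo n f ≡ sumTo n g
sumTo-cong zero    f≗g = f≗g 0
sumTo-cong (suc n) f≗g = cong₂ _+_ (sumTo-cong n f≗g) (f≗g (suc n))

sumTo-+ : ∀ n (f g : ℕ → ℚ) → sumTo n (λ k → f k + g k) ≡ sumTo n f + sumTo n g
sumTo-+ zero    f g = refl
sumTo-+ (suc n) f g = begin
  sumTo n (λ k → f k + g k) + (f (suc n) + g (suc n))
    ≡⟨ cong (_+ (f (suc n) + g (suc n))) (sumTo-+ n f g) ⟩
  (sumTo n f + sumTo n g) + (f (suc n) + g (suc n))
    ≡⟨ ℚ+.interchange (sumTo n f) (sumTo n g) (f (suc n)) (g (suc n)) ⟩
  (sumTo n f + f (suc n)) + (sumTo n g + g (suc n)) ∎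
  where open ≡-Reasoning

sumTo-*ˡ : ∀ n c (f : ℕ → ℚ) → sumTo n (λ k → c * f k) ≡ c * sumTo n f
sumTo-*ˡ zero    c f = refl
sumTo-*ˡ (suc n) c f =
  trans (cong (_+ c * f (suc n)) (sumTo-*ˡ n c f)) (sym (ℚ.*-distribˡ-+ c (sumTo n f) (f (suc n))))

sumTo-shift : ∀ n (f : ℕ → ℚ) → sumTo (suc n) f ≡ f 0 + sumTo n (λ k → f (suc k))
sumTo-shift zero    f = refl
sumTo-shift (suc n) f = trans (cong (_+ f (suc (suc n))) (sumTo-shift n f)) (ℚ.+-assoc (f 0) _ _)

Δ : ℕ → (ℕ → ℚ) → ℚ
Δ i f = sumTo i (λ k → sgn k * ℕ→ℚ (i C k) * f k)

Δ-cong : ∀ i {f g : ℕ → ℚ} → (∀ k → f k ≡ g k) → Δ i f ≡ Δ i g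
Δ-cong i f≗g = sumTo-cong i (λ k → cong (sgn k * ℕ→ℚ (i C k) *_) (f≗g k))

Δ-+ : ∀ i (f g : ℕ → ℚ) → Δ i (λ k → f k + g k) ≡ Δ i f + Δ i g
Δ-+ i f g = trans (sumTo-cong i (λ k → ℚ.*-distribˡ-+ (sgn k * ℕ→ℚ (i C k)) (f k) (g k))) (sumTo-+ i _ _)

Δ-*ˡ : ∀ i c (f : ℕ → ℚ) → Δ i (λ k → c * f k) ≡ c * Δ i f
Δ-*ˡ i c f = trans (sumTo-cong i (λ k → ℚ*.x∙yz≈y∙xz (sgn k * ℕ→ℚ (i C k)) c (f k))) (sumTo-*ˡ i c _)

Δ-*ʳ : ∀ i c (f : ℕ → ℚ) → Δ i (λ k → f k * c) ≡ Δ i f * c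
Δ-*ʳ i c f = trans (Δ-cong i (λ k → ℚ.*-comm (f k) c)) (trans (Δ-*ˡ i c f) (ℚ.*-comm c (Δ i f)))

Δ-- : ∀ i (f g : ℕ → ℚ) → Δ i (λ k → f k - g k) ≡ Δ i f - Δ i g
Δ-- i f g = begin
  Δ i (λ k → f k - g k)           ≡⟨ Δ-+ i f (λ k → - g k) ⟩
  Δ i f + Δ i (λ k → - g k)       ≡⟨ cong (λ u → Δ i f + u) (Δ-cong i (λ k → -1*x≈-x (g k))) ⟨
  Δ i f + Δ i (λ k → - 1ℚ * g k)  ≡⟨ cong (λ u → Δ i f + u) (Δ-*ˡ i (- 1ℚ) g) ⟩
  Δ i f + - 1ℚ * Δ i g            ≡⟨ cong (λ u → Δ i f + u) (-1*x≈-x (Δ i g)) ⟩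
  Δ i f - Δ i g                   ∎
  where open ≡-Reasoning

Δ--+ : ∀ i (f g h : ℕ → ℚ) → Δ i (λ k → f k - g k + h k) ≡ Δ i f - Δ i g + Δ i h
Δ--+ i f g h = trans (Δ-+ i (λ k → f k - g k) h) (cong (_+ Δ i h) (Δ-- i f g))

Δ-zero : ∀ (f : ℕ → ℚ) → Δ 0 f ≡ f 0
Δ-zero f = ℚ.*-identityˡ (f 0)

Δ-suc : ∀ i (f : ℕ → ℚ) → Δ (suc i) f ≡ Δ i (λ k → f k - f (suc k))
Δ-suc i f = begin
  Δ (suc i) f                                          ≡⟨ sumTo-shift i g ⟩
  g 0 + sumTo i (λ k → g (suc k))                      ≡⟨ cong (λ u → g 0 + u) (sumTo-cong i pascal) ⟩
  g 0 + sumTo i (λ k → h (suc k) + w k * - f (suc k))  ≡⟨ cong (λ u → g 0 + u) (sumTo-+ i _ _) ⟩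
  h 0 + (sumTo i (λ k → h (suc k)) + Δ i f′)           ≡⟨ ℚ.+-assoc (h 0) _ _ ⟨
  h 0 + sumTo i (λ k → h (suc k)) + Δ i f′             ≡⟨ cong (_+ Δ i f′) (sumTo-shift i h) ⟨
  sumTo (suc i) h + Δ i f′                             ≡⟨ cong (λ u → sumTo i h + u + Δ i f′) last-vanishes ⟩
  Δ i f + 0ℚ + Δ i f′                                  ≡⟨ cong (_+ Δ i f′) (ℚ.+-identityʳ (Δ i f)) ⟩
  Δ i f + Δ i f′                                       ≡⟨ Δ-+ i f f′ ⟨
  Δ i (λ k → f k - f (suc k))                          ∎
  where
  open ≡-Reasoning
  w : ℕ → ℚ
  w k = sgn k * ℕ→ℚ (i C k)
  g h f′ : ℕ → ℚ
  g k = sgn k * ℕ→ℚ (suc i C k) * f k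
  h k = w k * f k
  f′ k = - f (suc k)
  split : ∀ s a b x → (- s) * (a + b) * x ≡ (- s) * b * x + s * a * (- x)
  split = solve-∀ ℚ-ring
  pascal : ∀ k → g (suc k) ≡ h (suc k) + w k * - f (suc k)
  pascal k = begin
    (- sgn k) * ℕ→ℚ (suc i C suc k) * f (suc k)
      ≡⟨ cong (λ n → (- sgn k) * ℕ→ℚ n * f (suc k)) (nCk+nC[k+1]≡[n+1]C[k+1] i k) ⟨
    (- sgn k) * ℕ→ℚ (i C k ℕ.+ i C suc k) * f (suc k)
      ≡⟨ cong (λ u → (- sgn k) * u * f (suc k)) (ℕ→ℚ-+ (i C k) (i C suc k)) ⟩
    (- sgn k) * (ℕ→ℚ (i C k) + ℕ→ℚ (i C suc k)) * f (suc k)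
      ≡⟨ split (sgn k) (ℕ→ℚ (i C k)) (ℕ→ℚ (i C suc k)) (f (suc k)) ⟩
    h (suc k) + w k * - f (suc k) ∎
  last-vanishes : h (suc i) ≡ 0ℚ
  last-vanishes = begin
    sgn (suc i) * ℕ→ℚ (i C suc i) * f (suc i)
      ≡⟨ cong (λ n → sgn (suc i) * ℕ→ℚ n * f (suc i)) (k>n⇒nCk≡0 (ℕ.n<1+n i)) ⟩
    sgn (suc i) * 0ℚ * f (suc i)
      ≡⟨ cong (_* f (suc i)) (ℚ.*-zeroʳ (sgn (suc i))) ⟩
    0ℚ * f (suc i)
      ≡⟨ ℚ.*-zeroˡ (f (suc i)) ⟩
    0ℚ ∎

Δ-suc-∇ : ∀ i c {f g : ℕ → ℚ} → (∀ k → f k - f (suc k) ≡ c * g k) → Δ (suc i) f ≡ c * Δ i g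
Δ-suc-∇ i c {f} {g} ∇f≡cg = trans (Δ-suc i f) (trans (Δ-cong i ∇f≡cg) (Δ-*ˡ i c g))

falling-suc : ∀ x m → suc x falling suc m ≡ x falling suc m ℕ.+ suc m ℕ.* (x falling m)
falling-suc zero    zero    = refl
falling-suc zero    (suc m) = sym (ℕ.*-zeroʳ (suc (suc m)))
falling-suc (suc y) zero    = ℕ.+-comm 1 (suc y ℕ.* 1)
falling-suc (suc y) (suc m) =
  trans (cong (λ u → X ℕ.+ suc y ℕ.* u) (falling-suc y m)) (regroup y m X (y falling suc m) (y falling m))
  where
  X = suc y falling suc m
  regroup : ∀ y m X Y Z →
            X ℕ.+ suc y ℕ.* (Y ℕ.+ suc m ℕ.* Z) ≡ suc y ℕ.* Y ℕ.+ (X ℕ.+ suc m ℕ.* (suc y ℕ.* Z))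
  regroup = ℕ-solve-∀

falling-zero : ∀ {n m} → n ℕ.< m → n falling m ≡ 0
falling-zero {zero}  {suc m} _         = refl
falling-zero {suc n} {suc m} (ℕ.s≤s p) = trans (cong (suc n ℕ.*_) (falling-zero p)) (ℕ.*-zeroʳ (suc n))

falling-self : ∀ n → n falling n ≡ n !
falling-self zero    = refl
falling-self (suc n) = cong (suc n ℕ.*_) (falling-self n)

falling-*-! : ∀ m n → (m ℕ.+ n) falling m ℕ.* n ! ≡ (m ℕ.+ n) !
falling-*-! zero    n = ℕ.+-identityʳ (n !)
falling-*-! (suc m) n =
  trans (ℕ.*-assoc (suc (m ℕ.+ n)) ((m ℕ.+ n) falling m) (n !)) (cong (suc (m ℕ.+ n) ℕ.*_) (falling-*-! m n))

falling-*-0-falling : ∀ {i j} → i ≢ j → j falling i ℕ.* 0 falling (j ℕ.∸ i) ≡ 0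
falling-*-0-falling {i} {j} i≢j with ℕ.<-cmp i j
... | tri< i<j _ _ = trans (cong (j falling i ℕ.*_) (falling-zero (ℕ.m<n⇒0<n∸m i<j))) (ℕ.*-zeroʳ (j falling i))
... | tri≈ _ i≡j _ = contradiction i≡j i≢j
... | tri> _ _ j<i = cong (ℕ._* 0 falling (j ℕ.∸ i)) (falling-zero j<i)

Δ-falling : ∀ i a m →
  Δ i (λ k → ℕ→ℚ ((k ℕ.+ a) falling m)) ≡ sgn i * ℕ→ℚ (m falling i) * ℕ→ℚ (a falling (m ℕ.∸ i))
Δ-falling zero    a m       =
  trans (Δ-zero (λ k → ℕ→ℚ ((k ℕ.+ a) falling m))) (sym (ℚ.*-identityˡ (ℕ→ℚ (a falling m))))
Δ-falling (suc i) a zero    = begin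
  Δ (suc i) (λ k → 1ℚ)                  ≡⟨ Δ-suc-∇ i 0ℚ {g = λ k → 1ℚ} (λ k → refl) ⟩
  0ℚ * Δ i (λ k → 1ℚ)                   ≡⟨ ℚ.*-zeroˡ (Δ i (λ k → 1ℚ)) ⟩
  0ℚ                                    ≡⟨ ℚ.*-zeroˡ 1ℚ ⟨
  0ℚ * 1ℚ                               ≡⟨ cong (_* 1ℚ) (ℚ.*-zeroʳ (sgn (suc i))) ⟨
  sgn (suc i) * 0ℚ * ℕ→ℚ (a falling 0)  ∎
  where open ≡-Reasoning
Δ-falling (suc i) a (suc m) = begin
  Δ (suc i) (λ k → ℕ→ℚ ((k ℕ.+ a) falling suc m))
    ≡⟨ Δ-suc-∇ i (- ℕ→ℚ (suc m)) ∇falling ⟩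
  - ℕ→ℚ (suc m) * Δ i (λ k → ℕ→ℚ ((k ℕ.+ a) falling m))
    ≡⟨ cong (- ℕ→ℚ (suc m) *_) (Δ-falling i a m) ⟩
  - ℕ→ℚ (suc m) * (sgn i * ℕ→ℚ (m falling i) * ℕ→ℚ (a falling (m ℕ.∸ i)))
    ≡⟨ regroup (ℕ→ℚ (suc m)) (sgn i) (ℕ→ℚ (m falling i)) (ℕ→ℚ (a falling (m ℕ.∸ i))) ⟩
  - sgn i * (ℕ→ℚ (suc m) * ℕ→ℚ (m falling i)) * ℕ→ℚ (a falling (m ℕ.∸ i))
    ≡⟨ cong (λ u → - sgn i * u * ℕ→ℚ (a falling (m ℕ.∸ i))) (ℕ→ℚ-* (suc m) (m falling i)) ⟨
  sgn (suc i) * ℕ→ℚ (suc m falling suc i) * ℕ→ℚ (a falling (suc m ℕ.∸ suc i)) ∎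
  where
  open ≡-Reasoning
  regroup : ∀ c s p q → - c * (s * p * q) ≡ - s * (c * p) * q
  regroup = solve-∀ ℚ-ring
  cancel : ∀ x c z → x - (x + c * z) ≡ - c * z
  cancel = solve-∀ ℚ-ring
  ∇falling : ∀ k → ℕ→ℚ ((k ℕ.+ a) falling suc m) - ℕ→ℚ ((suc k ℕ.+ a) falling suc m)
                   ≡ - ℕ→ℚ (suc m) * ℕ→ℚ ((k ℕ.+ a) falling m)
  ∇falling k = begin
    ℕ→ℚ X - ℕ→ℚ (suc x falling suc m)
      ≡⟨ cong (λ n → ℕ→ℚ X - ℕ→ℚ n) (falling-suc x m) ⟩
    ℕ→ℚ X - ℕ→ℚ (X ℕ.+ suc m ℕ.* (x falling m))
      ≡⟨ cong (λ u → ℕ→ℚ X - u) (ℕ→ℚ-+ X (suc m ℕ.* (x falling m))) ⟩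
    ℕ→ℚ X - (ℕ→ℚ X + ℕ→ℚ (suc m ℕ.* (x falling m)))
      ≡⟨ cong (λ u → ℕ→ℚ X - (ℕ→ℚ X + u)) (ℕ→ℚ-* (suc m) (x falling m)) ⟩
    ℕ→ℚ X - (ℕ→ℚ X + ℕ→ℚ (suc m) * ℕ→ℚ (x falling m))
      ≡⟨ cancel (ℕ→ℚ X) (ℕ→ℚ (suc m)) (ℕ→ℚ (x falling m)) ⟩
    - ℕ→ℚ (suc m) * ℕ→ℚ (x falling m) ∎
    where
    x = k ℕ.+ a
    X = x falling suc m

rising : ℕ → ℕ → ℕ
rising x zero    = 1
rising x (suc m) = x ℕ.* rising (suc x) m

!-*-rising : ∀ n m → n ! ℕ.* rising (suc n) m ≡ (n ℕ.+ m) !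
!-*-rising n zero    = trans (ℕ.*-identityʳ (n !)) (cong _! (sym (ℕ.+-identityʳ n)))
!-*-rising n (suc m) = begin
  n ! ℕ.* (suc n ℕ.* rising (suc (suc n)) m)  ≡⟨ ℕ*.x∙yz≈yx∙z (n !) (suc n) (rising (suc (suc n)) m) ⟩
  suc n ! ℕ.* rising (suc (suc n)) m          ≡⟨ !-*-rising (suc n) m ⟩
  (suc n ℕ.+ m) !                             ≡⟨ cong _! (ℕ.+-suc n m) ⟨
  (n ℕ.+ suc m) !                             ∎
  where open ≡-Reasoning

rising-one : ∀ n → rising 1 n ≡ n !
rising-one n = trans (sym (ℕ.+-identityʳ (rising 1 n))) (!-*-rising 0 n)

rising-+ : ∀ x m n → rising x (m ℕ.+ n) ≡ rising x m ℕ.* rising (x ℕ.+ m) n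
rising-+ x zero    n = trans (cong (λ y → rising y n) (sym (ℕ.+-identityʳ x))) (sym (ℕ.+-identityʳ _))
rising-+ x (suc m) n = begin
  x ℕ.* rising (suc x) (m ℕ.+ n)
    ≡⟨ cong (x ℕ.*_) (rising-+ (suc x) m n) ⟩
  x ℕ.* (rising (suc x) m ℕ.* rising (suc x ℕ.+ m) n)
    ≡⟨ cong (λ y → x ℕ.* (rising (suc x) m ℕ.* rising y n)) (ℕ.+-suc x m) ⟨
  x ℕ.* (rising (suc x) m ℕ.* rising (x ℕ.+ suc m) n)
    ≡⟨ ℕ.*-assoc x _ _ ⟨
  x ℕ.* rising (suc x) m ℕ.* rising (x ℕ.+ suc m) n ∎
  where open ≡-Reasoning

recipRising : ℕ → ℕ → ℚ
recipRising x zero    = 1ℚ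
recipRising x (suc m) = + 1 / suc x * recipRising (suc x) m

recipRising-snoc : ∀ x m → recipRising x (suc m) ≡ recipRising x m * (+ 1 / suc (x ℕ.+ m))
recipRising-snoc x zero    = begin
  + 1 / suc x * 1ℚ            ≡⟨ ℚ.*-comm (+ 1 / suc x) 1ℚ ⟩
  1ℚ * (+ 1 / suc x)          ≡⟨ cong (λ n → 1ℚ * (+ 1 / suc n)) (ℕ.+-identityʳ x) ⟨
  1ℚ * (+ 1 / suc (x ℕ.+ 0))  ∎
  where open ≡-Reasoning
recipRising-snoc x (suc m) = begin
  + 1 / suc x * recipRising (suc x) (suc m)
    ≡⟨ cong (+ 1 / suc x *_) (recipRising-snoc (suc x) m) ⟩
  + 1 / suc x * (recipRising (suc x) m * (+ 1 / suc (suc x ℕ.+ m)))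
    ≡⟨ ℚ.*-assoc (+ 1 / suc x) _ _ ⟨
  recipRising x (suc m) * (+ 1 / suc (suc x ℕ.+ m))
    ≡⟨ cong (λ n → recipRising x (suc m) * (+ 1 / suc n)) (ℕ.+-suc x m) ⟨
  recipRising x (suc m) * (+ 1 / suc (x ℕ.+ suc m)) ∎
  where open ≡-Reasoning

recip-difference : ∀ x n →
  + 1 / suc x - + 1 / suc (suc (x ℕ.+ n)) ≡ ℕ→ℚ (suc n) * (+ 1 / suc x * (+ 1 / suc (suc (x ℕ.+ n))))
recip-difference x n = begin
  p - q                        ≡⟨ units p q ⟩
  1ℚ * p - 1ℚ * q              ≡⟨ cong₂ (λ u v → u * p - v * q) (1/n*n≡1 (suc (suc (x ℕ.+ n))))
                                                                  (1/n*n≡1 (suc x)) ⟨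
  q * Q * p - p * P * q        ≡⟨ cong (λ u → q * u * p - p * P * q) Q≡P+N ⟩
  q * (P + N) * p - p * P * q  ≡⟨ collect p q P N ⟩
  N * (p * q)                  ∎
  where
  open ≡-Reasoning
  p = + 1 / suc x
  q = + 1 / suc (suc (x ℕ.+ n))
  P = ℕ→ℚ (suc x)
  Q = ℕ→ℚ (suc (suc (x ℕ.+ n)))
  N = ℕ→ℚ (suc n)
  Q≡P+N : Q ≡ P + N
  Q≡P+N = trans (cong (λ m → ℕ→ℚ (suc m)) (sym (ℕ.+-suc x n))) (ℕ→ℚ-+ (suc x) (suc n))
  units : ∀ p q → p - q ≡ 1ℚ * p - 1ℚ * q
  units = solve-∀ ℚ-ring
  collect : ∀ p q P N → q * (P + N) * p - p * P * q ≡ N * (p * q)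
  collect = solve-∀ ℚ-ring

recipRising-∇ : ∀ x m → recipRising x m - recipRising (suc x) m ≡ ℕ→ℚ m * recipRising x (suc m)
recipRising-∇ x zero    = sym (ℚ.*-zeroˡ (recipRising x 1))
recipRising-∇ x (suc n) = begin
  p * U - recipRising (suc x) (suc n)        ≡⟨ cong (λ u → p * U - u) (recipRising-snoc (suc x) n) ⟩
  p * U - U * q                              ≡⟨ factor U p q ⟩
  U * (p - q)                                ≡⟨ cong (U *_) (recip-difference x n) ⟩
  U * (N * (p * q))                          ≡⟨ reassoc U N p q ⟩
  N * (p * (U * q))                          ≡⟨ cong (λ u → N * (p * u)) (recipRising-snoc (suc x) n) ⟨
  N * recipRising x (suc (suc n))            ∎
  where
  open ≡-Reasoning
  p = + 1 / suc x
  q = + 1 / suc (suc (x ℕ.+ n))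
  U = recipRising (suc x) n
  N = ℕ→ℚ (suc n)
  factor : ∀ U p q → p * U - U * q ≡ U * (p - q)
  factor = solve-∀ ℚ-ring
  reassoc : ∀ U c p q → U * (c * (p * q)) ≡ c * (p * (U * q))
  reassoc = solve-∀ ℚ-ring

Δ-recipRising : ∀ i a m → Δ i (λ k → recipRising (k ℕ.+ a) m) ≡ ℕ→ℚ (rising m i) * recipRising a (m ℕ.+ i)
Δ-recipRising zero    a m = begin
  Δ 0 (λ k → recipRising (k ℕ.+ a) m)  ≡⟨ Δ-zero (λ k → recipRising (k ℕ.+ a) m) ⟩
  recipRising a m                      ≡⟨ cong (recipRising a) (ℕ.+-identityʳ m) ⟨
  recipRising a (m ℕ.+ 0)              ≡⟨ ℚ.*-identityˡ (recipRising a (m ℕ.+ 0)) ⟨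
  1ℚ * recipRising a (m ℕ.+ 0)         ∎
  where open ≡-Reasoning
Δ-recipRising (suc i) a m = begin
  Δ (suc i) (λ k → recipRising (k ℕ.+ a) m)
    ≡⟨ Δ-suc-∇ i (ℕ→ℚ m) (λ k → recipRising-∇ (k ℕ.+ a) m) ⟩
  ℕ→ℚ m * Δ i (λ k → recipRising (k ℕ.+ a) (suc m))
    ≡⟨ cong (ℕ→ℚ m *_) (Δ-recipRising i a (suc m)) ⟩
  ℕ→ℚ m * (ℕ→ℚ (rising (suc m) i) * recipRising a (suc m ℕ.+ i))
    ≡⟨ ℚ.*-assoc (ℕ→ℚ m) _ _ ⟨
  ℕ→ℚ m * ℕ→ℚ (rising (suc m) i) * recipRising a (suc m ℕ.+ i)
    ≡⟨ cong₂ _*_ (ℕ→ℚ-* m (rising (suc m) i)) (cong (recipRising a) (ℕ.+-suc m i)) ⟨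
  ℕ→ℚ (rising m (suc i)) * recipRising a (m ℕ.+ suc i) ∎
  where open ≡-Reasoning

rising-*-recipRising : ∀ x m → ℕ→ℚ (rising (suc x) m) * recipRising x m ≡ 1ℚ
rising-*-recipRising x zero    = refl
rising-*-recipRising x (suc m) = begin
  ℕ→ℚ (suc x ℕ.* R) * (p * r)    ≡⟨ cong (_* (p * r)) (ℕ→ℚ-* (suc x) R) ⟩
  ℕ→ℚ (suc x) * ℕ→ℚ R * (p * r)  ≡⟨ ℚ*.interchange (ℕ→ℚ (suc x)) (ℕ→ℚ R) p r ⟩
  ℕ→ℚ (suc x) * p * (ℕ→ℚ R * r)  ≡⟨ cong (_* (ℕ→ℚ R * r)) (ℚ.*-comm (ℕ→ℚ (suc x)) p) ⟩
  p * ℕ→ℚ (suc x) * (ℕ→ℚ R * r)  ≡⟨ cong₂ _*_ (1/n*n≡1 (suc x)) (rising-*-recipRising (suc x) m) ⟩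
  1ℚ * 1ℚ                        ∎
  where
  open ≡-Reasoning
  p = + 1 / suc x
  R = rising (suc (suc x)) m
  r = recipRising (suc x) m

!-*-recipRising : ∀ n → ℕ→ℚ (n !) * recipRising 0 n ≡ 1ℚ
!-*-recipRising n = trans (cong (λ m → ℕ→ℚ m * recipRising 0 n) (sym (rising-one n))) (rising-*-recipRising 0 n)

ℕ→ℚ-*-recipRising : ∀ a n → ℕ→ℚ a * recipRising 0 n ≡ (+ a / n !) {{n ℕ.!≢0}}
ℕ→ℚ-*-recipRising a n = *≡⇒≡/ a (n !) {{n ℕ.!≢0}} (begin
  ℕ→ℚ (n !) * (ℕ→ℚ a * r)  ≡⟨ ℚ*.x∙yz≈y∙xz (ℕ→ℚ (n !)) (ℕ→ℚ a) r ⟩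
  ℕ→ℚ a * (ℕ→ℚ (n !) * r)  ≡⟨ cong (ℕ→ℚ a *_) (!-*-recipRising n) ⟩
  ℕ→ℚ a * 1ℚ               ≡⟨ ℚ.*-identityʳ (ℕ→ℚ a) ⟩
  ℕ→ℚ a                    ∎)
  where
  open ≡-Reasoning
  r = recipRising 0 n

falling-*-recipRising : ∀ m n → ℕ→ℚ ((m ℕ.+ n) falling m) * recipRising 0 (m ℕ.+ n) ≡ recipRising 0 n
falling-*-recipRising zero    n = ℚ.*-identityˡ (recipRising 0 n)
falling-*-recipRising (suc m) n = begin
  ℕ→ℚ (suc (m ℕ.+ n) ℕ.* F) * recipRising 0 (suc (m ℕ.+ n))
    ≡⟨ cong₂ _*_ (ℕ→ℚ-* (suc (m ℕ.+ n)) F) (recipRising-snoc 0 (m ℕ.+ n)) ⟩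
  ℕ→ℚ (suc (m ℕ.+ n)) * ℕ→ℚ F * (recipRising 0 (m ℕ.+ n) * (+ 1 / suc (m ℕ.+ n)))
    ≡⟨ reorder (ℕ→ℚ (suc (m ℕ.+ n))) (ℕ→ℚ F) (recipRising 0 (m ℕ.+ n)) (+ 1 / suc (m ℕ.+ n)) ⟩
  (+ 1 / suc (m ℕ.+ n)) * ℕ→ℚ (suc (m ℕ.+ n)) * (ℕ→ℚ F * recipRising 0 (m ℕ.+ n))
    ≡⟨ cong₂ _*_ (1/n*n≡1 (suc (m ℕ.+ n))) (falling-*-recipRising m n) ⟩
  1ℚ * recipRising 0 n
    ≡⟨ ℚ.*-identityˡ (recipRising 0 n) ⟩
  recipRising 0 n ∎
  where
  open ≡-Reasoning
  F = (m ℕ.+ n) falling m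
  reorder : ∀ a b c d → a * b * (c * d) ≡ d * a * (b * c)
  reorder = solve-∀ ℚ-ring

falling-*-!-*-recipRising : ∀ m n →
  ℕ→ℚ ((suc m ℕ.+ n) falling suc m) * (ℕ→ℚ (n !) * recipRising m (suc n)) ≡ ℕ→ℚ (m !)
falling-*-!-*-recipRising m n = begin
  ℕ→ℚ F * (ℕ→ℚ (n !) * r)  ≡⟨ ℚ.*-assoc (ℕ→ℚ F) (ℕ→ℚ (n !)) r ⟨
  ℕ→ℚ F * ℕ→ℚ (n !) * r    ≡⟨ cong (_* r) (ℕ→ℚ-* F (n !)) ⟨
  ℕ→ℚ (F ℕ.* n !) * r      ≡⟨ cong (λ x → ℕ→ℚ x * r) F*n!≡m!*R ⟩
  ℕ→ℚ (m ! ℕ.* R) * r      ≡⟨ cong (_* r) (ℕ→ℚ-* (m !) R) ⟩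
  ℕ→ℚ (m !) * ℕ→ℚ R * r    ≡⟨ ℚ.*-assoc (ℕ→ℚ (m !)) (ℕ→ℚ R) r ⟩
  ℕ→ℚ (m !) * (ℕ→ℚ R * r)  ≡⟨ cong (ℕ→ℚ (m !) *_) (rising-*-recipRising m (suc n)) ⟩
  ℕ→ℚ (m !) * 1ℚ           ≡⟨ ℚ.*-identityʳ (ℕ→ℚ (m !)) ⟩
  ℕ→ℚ (m !)                ∎
  where
  open ≡-Reasoning
  F = (suc m ℕ.+ n) falling suc m
  R = rising (suc m) (suc n)
  r = recipRising m (suc n)
  F*n!≡m!*R : F ℕ.* n ! ≡ m ! ℕ.* R
  F*n!≡m!*R = begin
    F ℕ.* n !        ≡⟨ falling-*-! (suc m) n ⟩
    (suc m ℕ.+ n) !  ≡⟨ cong _! (ℕ.+-suc m n) ⟨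
    (m ℕ.+ suc n) !  ≡⟨ !-*-rising m (suc n) ⟨
    m ! ℕ.* R        ∎

recip≡recipRising : ∀ m n .{{_ : NonZero m}} → m ≡ suc n → + 1 / m ≡ recipRising n 1
recip≡recipRising .(suc n) n refl = sym (ℚ.*-identityʳ (+ 1 / suc n))

factorialQuotient : ℕ → ℕ → ℚ
factorialQuotient k l = ℕ→ℚ ((l ℕ.+ (3 ℕ.+ k)) falling k) * recipRising 0 (3 ℕ.+ k)

kernel : ℕ → ℕ → ℚ
kernel k l = factorialQuotient k l - + 1 / (4 ℕ.+ k ℕ.+ l) + (+ 1 / (3 ℕ.+ k)) * (+ 1 / (3 ℕ.+ l))

[3+k+l]!≡falling*[3+l]! : ∀ k l → (3 ℕ.+ k ℕ.+ l) ! ≡ (l ℕ.+ (3 ℕ.+ k)) falling k ℕ.* (3 ℕ.+ l) !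
[3+k+l]!≡falling*[3+l]! k l = begin
  (3 ℕ.+ k ℕ.+ l) !
    ≡⟨ cong _! (3+k+l≡k+[3+l] k l) ⟩
  (k ℕ.+ (3 ℕ.+ l)) !
    ≡⟨ falling-*-! k (3 ℕ.+ l) ⟨
  (k ℕ.+ (3 ℕ.+ l)) falling k ℕ.* (3 ℕ.+ l) !
    ≡⟨ cong (λ n → n falling k ℕ.* (3 ℕ.+ l) !) (k+[3+l]≡l+[3+k] k l) ⟩
  (l ℕ.+ (3 ℕ.+ k)) falling k ℕ.* (3 ℕ.+ l) ! ∎
  where
  open ≡-Reasoning
  3+k+l≡k+[3+l] : ∀ k l → 3 ℕ.+ k ℕ.+ l ≡ k ℕ.+ (3 ℕ.+ l)
  3+k+l≡k+[3+l] = ℕ-solve-∀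
  k+[3+l]≡l+[3+k] : ∀ k l → k ℕ.+ (3 ℕ.+ l) ≡ l ℕ.+ (3 ℕ.+ k)
  k+[3+l]≡l+[3+k] = ℕ-solve-∀

factorial-part : ∀ k l →
  + 1 / (4 ℕ.+ k ℕ.+ l) * (+ (2 ℕ.* (4 ℕ.+ k ℕ.+ l) !) / ((3 ℕ.+ k) ! ℕ.* (3 ℕ.+ l) !))
                            {{ℕ._!*_!≢0 (3 ℕ.+ k) (3 ℕ.+ l)}}
    ≡ ℕ→ℚ 2 * factorialQuotient k l
factorial-part k l = begin
  + 1 / D * (+ (2 ℕ.* D !) / (K ℕ.* L))
    ≡⟨ /-*-/ 1 D (2 ℕ.* D !) (K ℕ.* L) ⟩
  + (1 ℕ.* (2 ℕ.* D !)) / (D ℕ.* (K ℕ.* L))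
    ≡⟨ /≡/ (1 ℕ.* (2 ℕ.* D !)) (D ℕ.* (K ℕ.* L)) (2 ℕ.* X) K cross ⟩
  + (2 ℕ.* X) / K
    ≡⟨ ℕ→ℚ-*-/ 2 X K ⟨
  ℕ→ℚ 2 * (+ X / K)
    ≡⟨ cong (ℕ→ℚ 2 *_) (ℕ→ℚ-*-recipRising X (3 ℕ.+ k)) ⟨
  ℕ→ℚ 2 * (ℕ→ℚ X * recipRising 0 (3 ℕ.+ k)) ∎
  where
  open ≡-Reasoning
  D = 4 ℕ.+ k ℕ.+ l
  K = (3 ℕ.+ k) !
  L = (3 ℕ.+ l) !
  X = (l ℕ.+ (3 ℕ.+ k)) falling k
  instance
    K≢0 : NonZero K
    K≢0 = ℕ._!≢0 (3 ℕ.+ k)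
    KL≢0 : NonZero (K ℕ.* L)
    KL≢0 = ℕ._!*_!≢0 (3 ℕ.+ k) (3 ℕ.+ l)
    DKL≢0 : NonZero (D ℕ.* (K ℕ.* L))
    DKL≢0 = ℕ.m*n≢0 D (K ℕ.* L)
  rearrange : ∀ D X K L → 1 ℕ.* (2 ℕ.* (D ℕ.* (X ℕ.* L))) ℕ.* K ≡ 2 ℕ.* X ℕ.* (D ℕ.* (K ℕ.* L))
  rearrange = ℕ-solve-∀
  cross : 1 ℕ.* (2 ℕ.* D !) ℕ.* K ≡ 2 ℕ.* X ℕ.* (D ℕ.* (K ℕ.* L))
  cross = trans (cong (λ n → 1 ℕ.* (2 ℕ.* (D ℕ.* n)) ℕ.* K) ([3+k+l]!≡falling*[3+l]! k l)) (rearrange D X K L)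

rational-part-identity : ∀ κ λ′ d u v →
  u * (ℕ→ℚ 3 + κ) ≡ 1ℚ → v * (ℕ→ℚ 3 + λ′) ≡ 1ℚ → d * (ℕ→ℚ 4 + κ + λ′) ≡ 1ℚ →
  d * (1ℚ + (1ℚ + κ) * (1ℚ + λ′) * (u * v)) ≡ ℕ→ℚ 2 * (d - u * v)
rational-part-identity κ λ′ d u v u⁻¹ v⁻¹ d⁻¹ = begin
  d * (1ℚ + N * (u * v))
    ≡⟨ cong (λ x → d * (x + N * (u * v))) (cong₂ _*_ u⁻¹ v⁻¹) ⟨
  d * (U * V + N * (u * v))
    ≡⟨ expand κ λ′ d u v ⟩
  ℕ→ℚ 2 * (d * (U * V) - u * v * (d * D))
    ≡⟨ cong₂ (λ x y → ℕ→ℚ 2 * (d * x - u * v * y)) (cong₂ _*_ u⁻¹ v⁻¹) d⁻¹ ⟩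
  ℕ→ℚ 2 * (d * (1ℚ * 1ℚ) - u * v * 1ℚ)
    ≡⟨ simplify d u v ⟩
  ℕ→ℚ 2 * (d - u * v) ∎
  where
  open ≡-Reasoning
  N = (1ℚ + κ) * (1ℚ + λ′)
  U = u * (ℕ→ℚ 3 + κ)
  V = v * (ℕ→ℚ 3 + λ′)
  D = ℕ→ℚ 4 + κ + λ′
  expand : ∀ κ λ′ d u v →
    d * (u * (ℕ→ℚ 3 + κ) * (v * (ℕ→ℚ 3 + λ′)) + (1ℚ + κ) * (1ℚ + λ′) * (u * v))
      ≡ ℕ→ℚ 2 * (d * (u * (ℕ→ℚ 3 + κ) * (v * (ℕ→ℚ 3 + λ′))) - u * v * (d * (ℕ→ℚ 4 + κ + λ′)))
  expand = solve-∀ ℚ-ring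
  simplify : ∀ d u v → ℕ→ℚ 2 * (d * (1ℚ * 1ℚ) - u * v * 1ℚ) ≡ ℕ→ℚ 2 * (d - u * v)
  simplify = solve-∀ ℚ-ring

rational-part : ∀ k l →
  + 1 / (4 ℕ.+ k ℕ.+ l) * (1ℚ + + ((1 ℕ.+ k) ℕ.* (1 ℕ.+ l)) / ((3 ℕ.+ k) ℕ.* (3 ℕ.+ l)))
    ≡ ℕ→ℚ 2 * (+ 1 / (4 ℕ.+ k ℕ.+ l) - (+ 1 / (3 ℕ.+ k)) * (+ 1 / (3 ℕ.+ l)))
rational-part k l = begin
  d * (1ℚ + + ((1 ℕ.+ k) ℕ.* (1 ℕ.+ l)) / ((3 ℕ.+ k) ℕ.* (3 ℕ.+ l)))
    ≡⟨ cong (λ x → d * (1ℚ + x)) G≡N*u*v ⟩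
  d * (1ℚ + (1ℚ + κ) * (1ℚ + λ′) * (u * v))
    ≡⟨ rational-part-identity κ λ′ d u v (recip 2 k) (recip 2 l) d⁻¹ ⟩
  ℕ→ℚ 2 * (d - u * v) ∎
  where
  open ≡-Reasoning
  κ = ℕ→ℚ k
  λ′ = ℕ→ℚ l
  d = + 1 / (4 ℕ.+ k ℕ.+ l)
  u = + 1 / (3 ℕ.+ k)
  v = + 1 / (3 ℕ.+ l)
  recip : ∀ a n → (+ 1 / (suc a ℕ.+ n)) * (ℕ→ℚ (suc a) + ℕ→ℚ n) ≡ 1ℚ
  recip a n = trans (cong ((+ 1 / (suc a ℕ.+ n)) *_) (sym (ℕ→ℚ-+ (suc a) n))) (1/n*n≡1 (suc a ℕ.+ n))
  4+k+l : ℕ→ℚ 4 + κ + λ′ ≡ ℕ→ℚ (4 ℕ.+ k ℕ.+ l)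
  4+k+l = trans (cong (_+ λ′) (sym (ℕ→ℚ-+ 4 k))) (sym (ℕ→ℚ-+ (4 ℕ.+ k) l))
  d⁻¹ : d * (ℕ→ℚ 4 + κ + λ′) ≡ 1ℚ
  d⁻¹ = trans (cong (d *_) 4+k+l) (1/n*n≡1 (4 ℕ.+ k ℕ.+ l))
  G≡N*u*v : + ((1 ℕ.+ k) ℕ.* (1 ℕ.+ l)) / ((3 ℕ.+ k) ℕ.* (3 ℕ.+ l)) ≡ (1ℚ + κ) * (1ℚ + λ′) * (u * v)
  G≡N*u*v = begin
    + ((1 ℕ.+ k) ℕ.* (1 ℕ.+ l)) / ((3 ℕ.+ k) ℕ.* (3 ℕ.+ l))
      ≡⟨ a/n≡a*1/n ((1 ℕ.+ k) ℕ.* (1 ℕ.+ l)) ((3 ℕ.+ k) ℕ.* (3 ℕ.+ l)) ⟩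
    ℕ→ℚ ((1 ℕ.+ k) ℕ.* (1 ℕ.+ l)) * (+ 1 / ((3 ℕ.+ k) ℕ.* (3 ℕ.+ l)))
      ≡⟨ cong₂ _*_ (trans (ℕ→ℚ-* (1 ℕ.+ k) (1 ℕ.+ l)) (cong₂ _*_ (ℕ→ℚ-+ 1 k) (ℕ→ℚ-+ 1 l)))
                   (sym (/-*-/ 1 (3 ℕ.+ k) 1 (3 ℕ.+ l))) ⟩
    (1ℚ + κ) * (1ℚ + λ′) * (u * v) ∎

bracket≡kernel : ∀ k l →
  + 1 / (4 ℕ.+ k ℕ.+ l) * ((+ (2 ℕ.* (4 ℕ.+ k ℕ.+ l) !) / ((3 ℕ.+ k) ! ℕ.* (3 ℕ.+ l) !))
                             {{ℕ._!*_!≢0 (3 ℕ.+ k) (3 ℕ.+ l)}}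
                           - 1ℚ - + ((1 ℕ.+ k) ℕ.* (1 ℕ.+ l)) / ((3 ℕ.+ k) ℕ.* (3 ℕ.+ l)))
    ≡ ℕ→ℚ 2 * kernel k l
bracket≡kernel k l = begin
  d * (F - 1ℚ - G)                                     ≡⟨ split d F G ⟩
  d * F - d * (1ℚ + G)                                 ≡⟨ cong₂ _-_ (factorial-part k l) (rational-part k l) ⟩
  ℕ→ℚ 2 * factorialQuotient k l - ℕ→ℚ 2 * (d - u * v)  ≡⟨ collect (factorialQuotient k l) d (u * v) ⟩
  ℕ→ℚ 2 * kernel k l                                   ∎
  where
  open ≡-Reasoning
  d = + 1 / (4 ℕ.+ k ℕ.+ l)
  u = + 1 / (3 ℕ.+ k)
  v = + 1 / (3 ℕ.+ l)
  F = (+ (2 ℕ.* (4 ℕ.+ k ℕ.+ l) !) / ((3 ℕ.+ k) ! ℕ.* (3 ℕ.+ l) !)) {{ℕ._!*_!≢0 (3 ℕ.+ k) (3 ℕ.+ l)}}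
  G = + ((1 ℕ.+ k) ℕ.* (1 ℕ.+ l)) / ((3 ℕ.+ k) ℕ.* (3 ℕ.+ l))
  split : ∀ d F G → d * (F - 1ℚ - G) ≡ d * F - d * (1ℚ + G)
  split = solve-∀ ℚ-ring
  collect : ∀ q d w → ℕ→ℚ 2 * q - ℕ→ℚ 2 * (d - w) ≡ ℕ→ℚ 2 * (q - d + w)
  collect = solve-∀ ℚ-ring

term≡kernel : ∀ i j k l →
  term i j k l ≡ sgn k * ℕ→ℚ (i C k) * (sgn l * ℕ→ℚ (j C l) * (ℕ→ℚ 2 * kernel k l))
term≡kernel i j k l = begin
  sgn (k ℕ.+ l) * d * ci * cj * B
    ≡⟨ cong (λ s → s * d * ci * cj * B) (sgn-+ k l) ⟩
  sgn k * sgn l * d * ci * cj * B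
    ≡⟨ regroup (sgn k) (sgn l) d ci cj B ⟩
  sgn k * ci * (sgn l * cj * (d * B))
    ≡⟨ cong (λ x → sgn k * ci * (sgn l * cj * x)) (bracket≡kernel k l) ⟩
  sgn k * ci * (sgn l * cj * (ℕ→ℚ 2 * kernel k l)) ∎
  where
  open ≡-Reasoning
  d = + 1 / (4 ℕ.+ k ℕ.+ l)
  ci = ℕ→ℚ (i C k)
  cj = ℕ→ℚ (j C l)
  B = (+ (2 ℕ.* (4 ℕ.+ k ℕ.+ l) !) / ((3 ℕ.+ k) ! ℕ.* (3 ℕ.+ l) !)) {{ℕ._!*_!≢0 (3 ℕ.+ k) (3 ℕ.+ l)}}
      - 1ℚ - + ((1 ℕ.+ k) ℕ.* (1 ℕ.+ l)) / ((3 ℕ.+ k) ℕ.* (3 ℕ.+ l))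
  regroup : ∀ s t d a b B → s * t * d * a * b * B ≡ s * a * (t * b * (d * B))
  regroup = solve-∀ ℚ-ring

σ̃≡ΔΔkernel : ∀ i j → σ̃ i j ≡ ℕ→ℚ 4 * Δ i (λ k → Δ j (kernel k))
σ̃≡ΔΔkernel i j = begin
  ℕ→ℚ 2 * sumTo i (λ k → sumTo j (λ l → term i j k l))
    ≡⟨ cong (ℕ→ℚ 2 *_) (sumTo-cong i (λ k → trans (sumTo-cong j (term≡kernel i j k))
                                                 (sumTo-*ˡ j (sgn k * ℕ→ℚ (i C k)) _))) ⟩
  ℕ→ℚ 2 * Δ i (λ k → Δ j (λ l → ℕ→ℚ 2 * kernel k l))
    ≡⟨ cong (ℕ→ℚ 2 *_) (Δ-cong i (λ k → Δ-*ˡ j (ℕ→ℚ 2) (kernel k))) ⟩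
  ℕ→ℚ 2 * Δ i (λ k → ℕ→ℚ 2 * Δ j (kernel k))
    ≡⟨ cong (ℕ→ℚ 2 *_) (Δ-*ˡ i (ℕ→ℚ 2) (λ k → Δ j (kernel k))) ⟩
  ℕ→ℚ 2 * (ℕ→ℚ 2 * Δ i (λ k → Δ j (kernel k)))
    ≡⟨ ℚ.*-assoc (ℕ→ℚ 2) (ℕ→ℚ 2) (Δ i (λ k → Δ j (kernel k))) ⟨
  ℕ→ℚ 4 * Δ i (λ k → Δ j (kernel k)) ∎
  where open ≡-Reasoning

falling-*-recipRising-∸ : ∀ a j k →
  ℕ→ℚ (k falling j) * (ℕ→ℚ ((a ℕ.+ k) falling (k ℕ.∸ j)) * recipRising 0 (a ℕ.+ k))
    ≡ ℕ→ℚ (k falling j) * recipRising 0 (a ℕ.+ j)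
falling-*-recipRising-∸ a j k with j ℕ.≤? k
... | yes j≤k = cong (ℕ→ℚ (k falling j) *_)
  (subst (λ n → ℕ→ℚ (n falling (k ℕ.∸ j)) * recipRising 0 n ≡ recipRising 0 (a ℕ.+ j))
         [k∸j]+[a+j]≡a+k (falling-*-recipRising (k ℕ.∸ j) (a ℕ.+ j)))
  where
  [k∸j]+[a+j]≡a+k : k ℕ.∸ j ℕ.+ (a ℕ.+ j) ≡ a ℕ.+ k
  [k∸j]+[a+j]≡a+k = trans (ℕ+.x∙yz≈y∙xz (k ℕ.∸ j) a j) (cong (a ℕ.+_) (ℕ.m∸n+n≡m j≤k))
... | no j≰k = begin
  ℕ→ℚ (k falling j) * x                        ≡⟨ cong (λ n → ℕ→ℚ n * x) k<j⇒0 ⟩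
  0ℚ * x                                       ≡⟨ ℚ.*-zeroˡ x ⟩
  0ℚ                                           ≡⟨ ℚ.*-zeroˡ (recipRising 0 (a ℕ.+ j)) ⟨
  0ℚ * recipRising 0 (a ℕ.+ j)                 ≡⟨ cong (λ n → ℕ→ℚ n * recipRising 0 (a ℕ.+ j)) k<j⇒0 ⟨
  ℕ→ℚ (k falling j) * recipRising 0 (a ℕ.+ j)  ∎
  where
  open ≡-Reasoning
  x = ℕ→ℚ ((a ℕ.+ k) falling (k ℕ.∸ j)) * recipRising 0 (a ℕ.+ k)
  k<j⇒0 : k falling j ≡ 0
  k<j⇒0 = falling-zero (ℕ.≰⇒> j≰k)

Δ-factorialQuotient : ∀ j k → Δ j (factorialQuotient k) ≡ sgn j * recipRising 0 (3 ℕ.+ j) * ℕ→ℚ (k falling j)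
Δ-factorialQuotient j k = begin
  Δ j (factorialQuotient k)
    ≡⟨ Δ-*ʳ j r (λ l → ℕ→ℚ ((l ℕ.+ (3 ℕ.+ k)) falling k)) ⟩
  Δ j (λ l → ℕ→ℚ ((l ℕ.+ (3 ℕ.+ k)) falling k)) * r
    ≡⟨ cong (_* r) (Δ-falling j (3 ℕ.+ k) k) ⟩
  sgn j * ℕ→ℚ (k falling j) * ℕ→ℚ ((3 ℕ.+ k) falling (k ℕ.∸ j)) * r
    ≡⟨ ℚ.*-assoc (sgn j * ℕ→ℚ (k falling j)) _ r ⟩
  sgn j * ℕ→ℚ (k falling j) * (ℕ→ℚ ((3 ℕ.+ k) falling (k ℕ.∸ j)) * r)
    ≡⟨ ℚ.*-assoc (sgn j) _ _ ⟩
  sgn j * (ℕ→ℚ (k falling j) * (ℕ→ℚ ((3 ℕ.+ k) falling (k ℕ.∸ j)) * r))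
    ≡⟨ cong (sgn j *_) (falling-*-recipRising-∸ 3 j k) ⟩
  sgn j * (ℕ→ℚ (k falling j) * recipRising 0 (3 ℕ.+ j))
    ≡⟨ ℚ*.x∙yz≈xz∙y (sgn j) _ _ ⟩
  sgn j * recipRising 0 (3 ℕ.+ j) * ℕ→ℚ (k falling j) ∎
  where
  open ≡-Reasoning
  r = recipRising 0 (3 ℕ.+ k)

ΔΔ-factorialQuotient : ∀ i j → Δ i (λ k → Δ j (factorialQuotient k))
  ≡ sgn j * recipRising 0 (3 ℕ.+ j) * (sgn i * ℕ→ℚ (j falling i ℕ.* 0 falling (j ℕ.∸ i)))
ΔΔ-factorialQuotient i j = begin
  Δ i (λ k → Δ j (factorialQuotient k))
    ≡⟨ Δ-cong i (Δ-factorialQuotient j) ⟩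
  Δ i (λ k → c * ℕ→ℚ (k falling j))
    ≡⟨ Δ-*ˡ i c (λ k → ℕ→ℚ (k falling j)) ⟩
  c * Δ i (λ k → ℕ→ℚ (k falling j))
    ≡⟨ cong (c *_) (Δ-cong i (λ k → cong (λ n → ℕ→ℚ (n falling j)) (ℕ.+-identityʳ k))) ⟨
  c * Δ i (λ k → ℕ→ℚ ((k ℕ.+ 0) falling j))
    ≡⟨ cong (c *_) (Δ-falling i 0 j) ⟩
  c * (sgn i * ℕ→ℚ A * ℕ→ℚ B)
    ≡⟨ cong (c *_) (trans (ℚ.*-assoc (sgn i) (ℕ→ℚ A) (ℕ→ℚ B)) (cong (sgn i *_) (sym (ℕ→ℚ-* A B)))) ⟩
  c * (sgn i * ℕ→ℚ (A ℕ.* B)) ∎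
  where
  open ≡-Reasoning
  c = sgn j * recipRising 0 (3 ℕ.+ j)
  A = j falling i
  B = 0 falling (j ℕ.∸ i)

ΔΔ-factorialQuotient-≢ : ∀ {i j} → i ≢ j → Δ i (λ k → Δ j (factorialQuotient k)) ≡ 0ℚ
ΔΔ-factorialQuotient-≢ {i} {j} i≢j = begin
  Δ i (λ k → Δ j (factorialQuotient k))
    ≡⟨ ΔΔ-factorialQuotient i j ⟩
  c * (sgn i * ℕ→ℚ (j falling i ℕ.* 0 falling (j ℕ.∸ i)))
    ≡⟨ cong (λ n → c * (sgn i * ℕ→ℚ n)) (falling-*-0-falling i≢j) ⟩
  c * (sgn i * 0ℚ)
    ≡⟨ cong (c *_) (ℚ.*-zeroʳ (sgn i)) ⟩
  c * 0ℚ
    ≡⟨ ℚ.*-zeroʳ c ⟩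
  0ℚ ∎
  where
  open ≡-Reasoning
  c = sgn j * recipRising 0 (3 ℕ.+ j)

ΔΔ-factorialQuotient-diag : ∀ j → Δ j (λ k → Δ j (factorialQuotient k)) ≡ + 1 / ((3 ℕ.+ j) falling 3)
ΔΔ-factorialQuotient-diag j = begin
  Δ j (λ k → Δ j (factorialQuotient k))
    ≡⟨ ΔΔ-factorialQuotient j j ⟩
  sgn j * r * (sgn j * ℕ→ℚ (j falling j ℕ.* 0 falling (j ℕ.∸ j)))
    ≡⟨ cong (λ n → sgn j * r * (sgn j * ℕ→ℚ n)) j!*1≡j! ⟩
  sgn j * r * (sgn j * ℕ→ℚ (j !))
    ≡⟨ regroup (sgn j) r (ℕ→ℚ (j !)) ⟩
  sgn j * sgn j * (ℕ→ℚ (j !) * r)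
    ≡⟨ cong (_* (ℕ→ℚ (j !) * r)) (sgn-*-sgn j) ⟩
  1ℚ * (ℕ→ℚ (j !) * r)
    ≡⟨ ℚ.*-identityˡ (ℕ→ℚ (j !) * r) ⟩
  ℕ→ℚ (j !) * r
    ≡⟨ *≡⇒≡/ 1 F F*j!*r≡1 ⟩
  + 1 / F ∎
  where
  open ≡-Reasoning
  r = recipRising 0 (3 ℕ.+ j)
  F = (3 ℕ.+ j) falling 3
  j!*1≡j! : j falling j ℕ.* 0 falling (j ℕ.∸ j) ≡ j !
  j!*1≡j! = trans (cong₂ (λ a n → a ℕ.* 0 falling n) (falling-self j) (ℕ.n∸n≡0 j)) (ℕ.*-identityʳ (j !))
  regroup : ∀ s r f → s * r * (s * f) ≡ s * s * (f * r)
  regroup = solve-∀ ℚ-ring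
  F*j!*r≡1 : ℕ→ℚ F * (ℕ→ℚ (j !) * r) ≡ ℕ→ℚ 1
  F*j!*r≡1 = begin
    ℕ→ℚ F * (ℕ→ℚ (j !) * r)      ≡⟨ ℚ*.x∙yz≈y∙xz (ℕ→ℚ F) (ℕ→ℚ (j !)) r ⟩
    ℕ→ℚ (j !) * (ℕ→ℚ F * r)      ≡⟨ cong (ℕ→ℚ (j !) *_) (falling-*-recipRising 3 j) ⟩
    ℕ→ℚ (j !) * recipRising 0 j  ≡⟨ !-*-recipRising j ⟩
    1ℚ                           ∎

Δ-1/[3+k] : ∀ i → Δ i (λ k → + 1 / (3 ℕ.+ k)) ≡ + 2 / ((3 ℕ.+ i) falling 3)
Δ-1/[3+k] i = begin
  Δ i (λ k → + 1 / (3 ℕ.+ k))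
    ≡⟨ Δ-cong i (λ k → recip≡recipRising (3 ℕ.+ k) (k ℕ.+ 2) (cong suc (ℕ.+-comm 2 k))) ⟩
  Δ i (λ k → recipRising (k ℕ.+ 2) 1)
    ≡⟨ Δ-recipRising i 2 1 ⟩
  ℕ→ℚ (rising 1 i) * recipRising 2 (suc i)
    ≡⟨ cong (λ n → ℕ→ℚ n * recipRising 2 (suc i)) (rising-one i) ⟩
  ℕ→ℚ (i !) * recipRising 2 (suc i)
    ≡⟨ *≡⇒≡/ 2 ((3 ℕ.+ i) falling 3) (falling-*-!-*-recipRising 2 i) ⟩
  + 2 / ((3 ℕ.+ i) falling 3) ∎
  where open ≡-Reasoning

ΔΔ-1/[4+k+l] : ∀ i j → Δ i (λ k → Δ j (λ l → + 1 / (4 ℕ.+ k ℕ.+ l))) ≡ + 6 / ((4 ℕ.+ i ℕ.+ j) falling 4)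
ΔΔ-1/[4+k+l] i j = begin
  Δ i (λ k → Δ j (λ l → + 1 / (4 ℕ.+ k ℕ.+ l)))
    ≡⟨ Δ-cong i (λ k → Δ-cong j (λ l →
         recip≡recipRising (4 ℕ.+ k ℕ.+ l) (l ℕ.+ (k ℕ.+ 3)) (4+k+l≡1+l+[k+3] k l))) ⟩
  Δ i (λ k → Δ j (λ l → recipRising (l ℕ.+ (k ℕ.+ 3)) 1))
    ≡⟨ Δ-cong i (λ k → Δ-recipRising j (k ℕ.+ 3) 1) ⟩
  Δ i (λ k → ℕ→ℚ (rising 1 j) * recipRising (k ℕ.+ 3) (suc j))
    ≡⟨ Δ-*ˡ i (ℕ→ℚ (rising 1 j)) (λ k → recipRising (k ℕ.+ 3) (suc j)) ⟩
  ℕ→ℚ (rising 1 j) * Δ i (λ k → recipRising (k ℕ.+ 3) (suc j))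
    ≡⟨ cong (ℕ→ℚ (rising 1 j) *_) (Δ-recipRising i 3 (suc j)) ⟩
  ℕ→ℚ (rising 1 j) * (ℕ→ℚ (rising (suc j) i) * r)
    ≡⟨ ℚ.*-assoc (ℕ→ℚ (rising 1 j)) (ℕ→ℚ (rising (suc j) i)) r ⟨
  ℕ→ℚ (rising 1 j) * ℕ→ℚ (rising (suc j) i) * r
    ≡⟨ cong (_* r) (ℕ→ℚ-* (rising 1 j) (rising (suc j) i)) ⟨
  ℕ→ℚ (rising 1 j ℕ.* rising (suc j) i) * r
    ≡⟨ cong (λ n → ℕ→ℚ n * r) (trans (sym (rising-one (j ℕ.+ i))) (rising-+ 1 j i)) ⟨
  ℕ→ℚ ((j ℕ.+ i) !) * r
    ≡⟨ *≡⇒≡/ 6 ((4 ℕ.+ (j ℕ.+ i)) falling 4) (falling-*-!-*-recipRising 3 (j ℕ.+ i)) ⟩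
  + 6 / ((4 ℕ.+ (j ℕ.+ i)) falling 4)
    ≡⟨ /-cong {+ 6} {_} {+ 6} refl (cong (_falling 4) 4+[j+i]≡4+i+j) ⟩
  + 6 / ((4 ℕ.+ i ℕ.+ j) falling 4) ∎
  where
  open ≡-Reasoning
  r = recipRising 3 (suc (j ℕ.+ i))
  4+k+l≡1+l+[k+3] : ∀ k l → 4 ℕ.+ k ℕ.+ l ≡ suc (l ℕ.+ (k ℕ.+ 3))
  4+k+l≡1+l+[k+3] = ℕ-solve-∀
  4+[j+i]≡4+i+j : 4 ℕ.+ (j ℕ.+ i) ≡ 4 ℕ.+ i ℕ.+ j
  4+[j+i]≡4+i+j = ℕ-solve (i ∷ j ∷ [])

ΔΔ-kernel-split : ∀ i j → Δ i (λ k → Δ j (kernel k))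
  ≡ Δ i (λ k → Δ j (factorialQuotient k)) - Δ i (λ k → Δ j (λ l → + 1 / (4 ℕ.+ k ℕ.+ l)))
    + Δ i (λ k → + 1 / (3 ℕ.+ k)) * Δ j (λ l → + 1 / (3 ℕ.+ l))
ΔΔ-kernel-split i j = begin
  Δ i (λ k → Δ j (kernel k))
    ≡⟨ Δ-cong i inner ⟩
  Δ i (λ k → Δ j (factorialQuotient k) - Δ j (d k) + u k * Δ j u)
    ≡⟨ Δ--+ i (λ k → Δ j (factorialQuotient k)) (λ k → Δ j (d k)) (λ k → u k * Δ j u) ⟩
  Δ i (λ k → Δ j (factorialQuotient k)) - Δ i (λ k → Δ j (d k)) + Δ i (λ k → u k * Δ j u)
    ≡⟨ cong (λ x → Δ i (λ k → Δ j (factorialQuotient k)) - Δ i (λ k → Δ j (d k)) + x) (Δ-*ʳ i (Δ j u) u) ⟩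
  Δ i (λ k → Δ j (factorialQuotient k)) - Δ i (λ k → Δ j (d k)) + Δ i u * Δ j u ∎
  where
  open ≡-Reasoning
  d : ℕ → ℕ → ℚ
  d k l = + 1 / (4 ℕ.+ k ℕ.+ l)
  u : ℕ → ℚ
  u k = + 1 / (3 ℕ.+ k)
  inner : ∀ k → Δ j (kernel k) ≡ Δ j (factorialQuotient k) - Δ j (d k) + u k * Δ j u
  inner k = trans (Δ--+ j (factorialQuotient k) (d k) (λ l → u k * u l))
                  (cong (λ x → Δ j (factorialQuotient k) - Δ j (d k) + x) (Δ-*ˡ j (u k) u))

σ̃-closed : ∀ i j → σ̃ i j ≡ ℕ→ℚ 4 * Δ i (λ k → Δ j (factorialQuotient k))
                            + + 16 / (((3 ℕ.+ i) falling 3) ℕ.* ((3 ℕ.+ j) falling 3))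
                            - + 24 / ((4 ℕ.+ i ℕ.+ j) falling 4)
σ̃-closed i j = begin
  σ̃ i j
    ≡⟨ σ̃≡ΔΔkernel i j ⟩
  ℕ→ℚ 4 * Δ i (λ k → Δ j (kernel k))
    ≡⟨ cong (ℕ→ℚ 4 *_) (ΔΔ-kernel-split i j) ⟩
  ℕ→ℚ 4 * (X - Δ i (λ k → Δ j (λ l → + 1 / (4 ℕ.+ k ℕ.+ l)))
             + Δ i (λ k → + 1 / (3 ℕ.+ k)) * Δ j (λ l → + 1 / (3 ℕ.+ l)))
    ≡⟨ cong₂ (λ y z → ℕ→ℚ 4 * (X - y + z)) (ΔΔ-1/[4+k+l] i j) (cong₂ _*_ (Δ-1/[3+k] i) (Δ-1/[3+k] j)) ⟩
  ℕ→ℚ 4 * (X - + 6 / G + + 2 / F i * (+ 2 / F j))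
    ≡⟨ distribute (ℕ→ℚ 4) X (+ 6 / G) (+ 2 / F i * (+ 2 / F j)) ⟩
  ℕ→ℚ 4 * X + ℕ→ℚ 4 * (+ 2 / F i * (+ 2 / F j)) - ℕ→ℚ 4 * (+ 6 / G)
    ≡⟨ cong₂ (λ y z → ℕ→ℚ 4 * X + y - z) 4*[2/F*2/F]≡16/FF (ℕ→ℚ-*-/ 4 6 G) ⟩
  ℕ→ℚ 4 * X + + 16 / (F i ℕ.* F j) - + 24 / G ∎
  where
  open ≡-Reasoning
  X = Δ i (λ k → Δ j (factorialQuotient k))
  F : ℕ → ℕ
  F n = (3 ℕ.+ n) falling 3
  G = (4 ℕ.+ i ℕ.+ j) falling 4
  4*[2/F*2/F]≡16/FF : ℕ→ℚ 4 * (+ 2 / F i * (+ 2 / F j)) ≡ + 16 / (F i ℕ.* F j)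
  4*[2/F*2/F]≡16/FF = trans (cong (ℕ→ℚ 4 *_) (/-*-/ 2 (F i) 2 (F j))) (ℕ→ℚ-*-/ 4 4 (F i ℕ.* F j))
  distribute : ∀ c x y z → c * (x - y + z) ≡ c * x + c * z - c * y
  distribute = solve-∀ ℚ-ring

σ̃-off-diagonal : (i j : ℕ) → i ≢ j →
  σ̃ i j ≡ + 16 / (((3 ℕ.+ i) falling 3) ℕ.* ((3 ℕ.+ j) falling 3)) - + 24 / ((4 ℕ.+ i ℕ.+ j) falling 4)
σ̃-off-diagonal i j i≢j = begin
  σ̃ i j
    ≡⟨ σ̃-closed i j ⟩
  ℕ→ℚ 4 * Δ i (λ k → Δ j (factorialQuotient k)) + A - B
    ≡⟨ cong (λ x → ℕ→ℚ 4 * x + A - B) (ΔΔ-factorialQuotient-≢ i≢j) ⟩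
  0ℚ + A - B
    ≡⟨ cong (_- B) (ℚ.+-identityˡ A) ⟩
  A - B ∎
  where
  open ≡-Reasoning
  A = + 16 / (((3 ℕ.+ i) falling 3) ℕ.* ((3 ℕ.+ j) falling 3))
  B = + 24 / ((4 ℕ.+ i ℕ.+ j) falling 4)

σ̃-diagonal : (j : ℕ) →
  σ̃ j j ≡ + 4 / ((3 ℕ.+ j) falling 3) + + 16 / (((3 ℕ.+ j) falling 3) ℕ.* ((3 ℕ.+ j) falling 3))
          - + 24 / ((4 ℕ.+ 2 ℕ.* j) falling 4)
σ̃-diagonal j = begin
  σ̃ j j
    ≡⟨ σ̃-closed j j ⟩
  ℕ→ℚ 4 * Δ j (λ k → Δ j (factorialQuotient k)) + A - B′
    ≡⟨ cong₂ (λ x y → ℕ→ℚ 4 * x + A - y) (ΔΔ-factorialQuotient-diag j) B′≡B ⟩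
  ℕ→ℚ 4 * (+ 1 / F) + A - B
    ≡⟨ cong (λ x → x + A - B) (ℕ→ℚ-*-/ 4 1 F) ⟩
  + 4 / F + A - B ∎
  where
  open ≡-Reasoning
  F = (3 ℕ.+ j) falling 3
  A = + 16 / (F ℕ.* F)
  B′ = + 24 / ((4 ℕ.+ j ℕ.+ j) falling 4)
  B = + 24 / ((4 ℕ.+ 2 ℕ.* j) falling 4)
  4+j+j≡4+2j : 4 ℕ.+ j ℕ.+ j ≡ 4 ℕ.+ 2 ℕ.* j
  4+j+j≡4+2j = ℕ-solve (j ∷ [])
  B′≡B : B′ ≡ B
  B′≡B = /-cong {+ 24} {_} {+ 24} refl (cong (_falling 4) 4+j+j≡4+2j)

proposition1 :
    ((i j : ℕ) → i ≢ j →
      σ̃ i j ≡ (+ 16 / (((3 ℕ.+ i) falling 3) ℕ.* ((3 ℕ.+ j) falling 3)))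
               - (+ 24 / ((4 ℕ.+ i ℕ.+ j) falling 4)))
    × ((j : ℕ) →
      σ̃ j j ≡ (+ 4 / ((3 ℕ.+ j) falling 3))
               + (+ 16 / (((3 ℕ.+ j) falling 3) ℕ.* ((3 ℕ.+ j) falling 3)))
               - (+ 24 / ((4 ℕ.+ 2 ℕ.* j) falling 4)))
proposition1 = σ̃-off-diagonal , σ̃-diagonal
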